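{- The (outer) univalent multirelations form a category with sets as objects, univalent multirelations $X \leftrightarrow \mathcal{P} Y$ as arrows from $X$ to $Y$, Peleg composition $\ast$ as composition and $1_X$ as identity arrows. The same holds for the (outer) deterministic multirelations.
   Context: A multirelation $R : X \leftrightarrow \mathcal{P} Y$ is a subset of $X \times \mathcal{P} Y$. $R$ is (outer) univalent if each $a \in X$ is related to at most one set, and (outer) deterministic if each $a \in X$ is related to exactly one set. $1_X = \{(a,\{a\}) \mid a \in X\}$. Peleg composition of $R : X \leftrightarrow \mathcal{P} Y$, $S : Y \leftrightarrow \mathcal{P} Z$: $R \ast S = \{(a,C) \mid \exists B.\ (a,B) \in R \wedge \exists f : Y \to \mathcal{P} Z.\ (\forall b \in B.\ (b,f(b)) \in S) \wedge C = \bigcup_{b \in B} f(b)\}$. -}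

module Defs where

open import Level using (0ℓ; Lift)
open import Data.Product using (Σ; ∃; _×_; _,_)
open import Relation.Unary using (Pred; _≐_)
open import Relation.Binary.PropositionalEquality using (_≡_)

-- Power set 𝒫 Y : subsets of Y, as predicates; sets are compared
-- extensionally by _≐_ (mutual inclusion).
𝒫 : Set → Set₁
𝒫 Y = Pred Y 0ℓ

MRel : Set → Set → Set₂
MRel X Y = X → 𝒫 Y → Set₁

-- Being a subset of X × 𝒫 Y: membership respects equality of sets
-- (𝒫 Y is extensional, so a genuine subset of X × 𝒫 Y cannot
-- distinguish extensionally equal sets).
IsMultirel : ∀ {X Y} → MRel X Y → Set₁
IsMultirel {X} {Y} R = ∀ {a : X} {B B′ : 𝒫 Y} → B ≐ B′ → R a B → R a B′

_≡ₘ_ : ∀ {X Y} → MRel X Y → MRel X Y → Set₁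
R ≡ₘ S = ∀ a C → (R a C → S a C) × (S a C → R a C)

⟦_⟧ : ∀ {Y} → Y → 𝒫 Y
⟦ y ⟧ = λ y′ → y′ ≡ y

⋃[_∈_]_ : ∀ {Y Z} → Set → 𝒫 Y → (Y → 𝒫 Z) → 𝒫 Z
⋃[_∈_]_ {Y} _ B f = λ z → Σ Y (λ b → B b × f b z)

1ₘ : (X : Set) → MRel X X
1ₘ X a B = Lift _ (B ≐ ⟦ a ⟧)

_⋆_ : ∀ {X Y Z} → MRel X Y → MRel Y Z → MRel X Z
_⋆_ {X} {Y} {Z} R S a C =
  Σ (𝒫 Y) λ B → R a B ×
    Σ (Y → 𝒫 Z) λ f → (∀ b → B b → S b (f b)) × (C ≐ (⋃[ Y ∈ B ] f))

IsUnivalent : ∀ {X Y} → MRel X Y → Set₁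
IsUnivalent {X} {Y} R = ∀ {a : X} {B B′ : 𝒫 Y} → R a B → R a B′ → B ≐ B′

IsDeterministic : ∀ {X Y} → MRel X Y → Set₁
IsDeterministic {X} {Y} R = (∀ (a : X) → ∃ λ (B : 𝒫 Y) → R a B) × IsUnivalent R

Univalent : ∀ {X Y} → MRel X Y → Set₁
Univalent R = IsMultirel R × IsUnivalent R

Deterministic : ∀ {X Y} → MRel X Y → Set₁
Deterministic R = IsMultirel R × IsDeterministic R

record IsCategory (P : ∀ {X Y : Set} → MRel X Y → Set₁) : Set₂ where
  field
    id-closed   : ∀ (X : Set) → P (1ₘ X)
    comp-closed : ∀ {X Y Z} {R : MRel X Y} {S : MRel Y Z} → P R → P S → P (R ⋆ S)
    comp-cong   : ∀ {X Y Z} {R R′ : MRel X Y} {S S′ : MRel Y Z} →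
                  P R → P R′ → P S → P S′ → R ≡ₘ R′ → S ≡ₘ S′ → (R ⋆ S) ≡ₘ (R′ ⋆ S′)
    identityˡ   : ∀ {X Y} {R : MRel X Y} → P R → (1ₘ X ⋆ R) ≡ₘ R
    identityʳ   : ∀ {X Y} {R : MRel X Y} → P R → (R ⋆ 1ₘ Y) ≡ₘ R
    assoc       : ∀ {W X Y Z} {R : MRel W X} {S : MRel X Y} {T : MRel Y Z} →
                  P R → P S → P T → ((R ⋆ S) ⋆ T) ≡ₘ (R ⋆ (S ⋆ T))

{-# OPTIONS --safe #-}
-- The identity laws and congruence hold for every multirelation that respects
-- equality of sets.  Associativity is the delicate law: a witness of
-- R ⋆ (S ⋆ T) chooses, for each b ∈ B and each proof of b ∈ B, its own
-- decomposition through S and T.  When S and T are univalent all these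
-- choices relate b (and each intermediate c) to the same set, so their union
-- is a single valid choice, which re-brackets the composite.
module Submission where

open import Defs
open import Level using (lift; lower)
open import Data.Product using (Σ; ∃; _×_; _,_; proj₁; proj₂)
open import Relation.Unary using (_≐_)
open import Relation.Unary.Properties using (≐-refl; ≐-sym; ≐-trans)
open import Relation.Binary.PropositionalEquality using (_≡_; refl)

IsTotal : ∀ {X Y} → MRel X Y → Set₁
IsTotal {X} {Y} R = ∀ (a : X) → ∃ λ (B : 𝒫 Y) → R a B

deterministic⇒univalent : ∀ {X Y} {R : MRel X Y} → Deterministic R → Univalent R
deterministic⇒univalent (isMultirel , _ , isUnivalent) = isMultirel , isUnivalent

univalent-⋃ : ∀ {X Y} {R : MRel X Y} → Univalent R →
              ∀ {a I} (i : I) (B : I → 𝒫 Y) → (∀ i → R a (B i)) →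
              R a (λ y → Σ I λ j → B j y)
univalent-⋃ (isMultirel , isUnivalent) i B rB =
  isMultirel ((λ y∈Bi → i , y∈Bi)
             , λ { (j , y∈Bj) → proj₁ (isUnivalent (rB j) (rB i)) y∈Bj })
             (rB i)

1ₘ-isMultirel : ∀ X → IsMultirel (1ₘ X)
1ₘ-isMultirel X B≐B′ (lift B≐a) = lift (≐-trans (≐-sym B≐B′) B≐a)

1ₘ-isUnivalent : ∀ X → IsUnivalent (1ₘ X)
1ₘ-isUnivalent X (lift B≐a) (lift B′≐a) = ≐-trans B≐a (≐-sym B′≐a)

1ₘ-isTotal : ∀ X → IsTotal (1ₘ X)
1ₘ-isTotal X a = ⟦ a ⟧ , lift ≐-refl

⋆-isMultirel : ∀ {X Y Z} (R : MRel X Y) (S : MRel Y Z) → IsMultirel (R ⋆ S)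
⋆-isMultirel R S C≐C′ (B , r , f , s , C≐⋃) = B , r , f , s , ≐-trans (≐-sym C≐C′) C≐⋃

⋆-isUnivalent : ∀ {X Y Z} {R : MRel X Y} {S : MRel Y Z} →
                IsUnivalent R → IsUnivalent S → IsUnivalent (R ⋆ S)
⋆-isUnivalent {Y = Y} unR unS (B , r , f , s , C≐⋃) (B′ , r′ , f′ , s′ , C′≐⋃) =
  ≐-trans C≐⋃ (≐-trans ⋃f≐⋃f′ (≐-sym C′≐⋃))
  where
  B≐B′ : B ≐ B′
  B≐B′ = unR r r′
  ⋃f≐⋃f′ : (⋃[ Y ∈ B ] f) ≐ (⋃[ Y ∈ B′ ] f′)
  ⋃f≐⋃f′ = (λ { (b , b∈B , z) →
                 b , proj₁ B≐B′ b∈B , proj₁ (unS (s b b∈B) (s′ b (proj₁ B≐B′ b∈B))) z })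
         , (λ { (b , b∈B′ , z) →
                 b , proj₂ B≐B′ b∈B′ , proj₂ (unS (s b (proj₂ B≐B′ b∈B′)) (s′ b b∈B′)) z })

⋆-isTotal : ∀ {X Y Z} {R : MRel X Y} {S : MRel Y Z} →
            IsTotal R → IsTotal S → IsTotal (R ⋆ S)
⋆-isTotal totR totS a =
  let (B , r) = totR a in
  _ , B , r , (λ b → proj₁ (totS b)) , (λ b _ → proj₂ (totS b)) , ≐-refl

⋆-cong : ∀ {X Y Z} {R R′ : MRel X Y} {S S′ : MRel Y Z} →
         R ≡ₘ R′ → S ≡ₘ S′ → (R ⋆ S) ≡ₘ (R′ ⋆ S′)
⋆-cong R≡R′ S≡S′ a C =
    (λ { (B , r , f , s , C≐⋃) →
         B , proj₁ (R≡R′ a B) r , f , (λ b b∈B → proj₁ (S≡S′ b (f b)) (s b b∈B)) , C≐⋃ })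
  , (λ { (B , r , f , s , C≐⋃) →
         B , proj₂ (R≡R′ a B) r , f , (λ b b∈B → proj₂ (S≡S′ b (f b)) (s b b∈B)) , C≐⋃ })

⋆-identityˡ : ∀ {X Y} {R : MRel X Y} → IsMultirel R → (1ₘ X ⋆ R) ≡ₘ R
⋆-identityˡ {X} {Y} {R} isMultirel a C = to , from
  where
  to : (1ₘ X ⋆ R) a C → R a C
  to (B , lift B≐a , f , s , C≐⋃) =
    isMultirel (≐-sym (≐-trans C≐⋃ ⋃f≐fa)) (s a a∈B)
    where
    a∈B = proj₂ B≐a refl
    ⋃f≐fa : (⋃[ X ∈ B ] f) ≐ f a
    ⋃f≐fa = (λ { (b , b∈B , z) → at-a (proj₁ B≐a b∈B) z }) , (λ z → a , a∈B , z)
      where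
      at-a : ∀ {b z} → b ≡ a → f b z → f a z
      at-a refl z = z
  from : R a C → (1ₘ X ⋆ R) a C
  from r = ⟦ a ⟧ , lift ≐-refl , (λ _ → C) , (λ { _ refl → r })
         , (λ z → a , refl , z) , (λ { (_ , refl , z) → z })

⋆-identityʳ : ∀ {X Y} {R : MRel X Y} → IsMultirel R → (R ⋆ 1ₘ Y) ≡ₘ R
⋆-identityʳ {X} {Y} {R} isMultirel a C = to , from
  where
  to : (R ⋆ 1ₘ Y) a C → R a C
  to (B , r , f , s , C≐⋃) = isMultirel (≐-sym (≐-trans C≐⋃ ⋃f≐B)) r
    where
    ⋃f≐B : (⋃[ Y ∈ B ] f) ≐ B
    ⋃f≐B = (λ { (b , b∈B , y∈fb) → in-B b∈B (proj₁ (lower (s b b∈B)) y∈fb) })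
         , (λ {y} y∈B → y , y∈B , proj₂ (lower (s y y∈B)) refl)
      where
      in-B : ∀ {y b} → B b → y ≡ b → B y
      in-B b∈B refl = b∈B
  from : R a C → (R ⋆ 1ₘ Y) a C
  from r = C , r , ⟦_⟧ , (λ _ _ → lift ≐-refl)
         , (λ {y} y∈C → y , y∈C , refl) , (λ { (_ , y∈C , refl) → y∈C })

⋆-assoc-⊆ : ∀ {W X Y Z} {R : MRel W X} {S : MRel X Y} {T : MRel Y Z} {a D} →
            ((R ⋆ S) ⋆ T) a D → (R ⋆ (S ⋆ T)) a D
⋆-assoc-⊆ {X = X} {Y} {Z} {S = S} {T} {D = D} (C , (B , r , f , s , C≐⋃f) , g , t , D≐⋃g) =
  B , r , h , st , D≐⋃h
  where
  h : X → 𝒫 Z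
  h b = ⋃[ Y ∈ f b ] g
  st : ∀ b → B b → (S ⋆ T) b (h b)
  st b b∈B = f b , s b b∈B , g , (λ c c∈fb → t c (proj₂ C≐⋃f (b , b∈B , c∈fb))) , ≐-refl
  D≐⋃h : D ≐ (⋃[ X ∈ B ] h)
  D≐⋃h = (λ z∈D → let (c , c∈C , z∈gc) = proj₁ D≐⋃g z∈D
                      (b , b∈B , c∈fb) = proj₁ C≐⋃f c∈C
                  in b , b∈B , c , c∈fb , z∈gc)
       , (λ { (b , b∈B , c , c∈fb , z∈gc) → proj₂ D≐⋃g (c , proj₂ C≐⋃f (b , b∈B , c∈fb) , z∈gc) })

⋆-assoc-⊇ : ∀ {W X Y Z} {R : MRel W X} {S : MRel X Y} {T : MRel Y Z} {a D} →
            Univalent S → Univalent T →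
            (R ⋆ (S ⋆ T)) a D → ((R ⋆ S) ⋆ T) a D
⋆-assoc-⊇ {X = X} {Y} {Z} {S = S} {T} {D = D} univS univT (B , r , h , st , D≐⋃h) =
  C , (B , r , f , fs , ≐-refl) , g , gt , D≐⋃g
  where
  F : ∀ b → B b → 𝒫 Y
  F b p = proj₁ (st b p)
  G : ∀ b → B b → Y → 𝒫 Z
  G b p = proj₁ (proj₂ (proj₂ (st b p)))
  FS : ∀ b p → S b (F b p)
  FS b p = proj₁ (proj₂ (st b p))
  GT : ∀ b p c → F b p c → T c (G b p c)
  GT b p = proj₁ (proj₂ (proj₂ (proj₂ (st b p))))
  hb≐⋃G : ∀ b p → h b ≐ (⋃[ Y ∈ F b p ] G b p)
  hb≐⋃G b p = proj₂ (proj₂ (proj₂ (proj₂ (st b p))))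

  f : X → 𝒫 Y
  f b c = Σ (B b) λ p → F b p c
  fs : ∀ b → B b → S b (f b)
  fs b p = univalent-⋃ univS p (F b) (FS b)
  C : 𝒫 Y
  C = ⋃[ X ∈ B ] f

  Source : Y → Set
  Source c = Σ X λ b → Σ (B b) λ p → F b p c
  g : Y → 𝒫 Z
  g c z = Σ (Source c) λ { (b , p , _) → G b p c z }
  gt : ∀ c → C c → T c (g c)
  gt c (b , _ , p , c∈F) =
    univalent-⋃ univT (b , p , c∈F) (λ { (b , p , _) → G b p c })
                      (λ { (b , p , c∈F) → GT b p c c∈F })

  D≐⋃g : D ≐ (⋃[ Y ∈ C ] g)
  D≐⋃g = (λ z∈D → let (b , p , z∈h) = proj₁ D≐⋃h z∈D
                      (c , c∈F , z∈G) = proj₁ (hb≐⋃G b p) z∈h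
                  in c , (b , p , p , c∈F) , (b , p , c∈F) , z∈G)
       , (λ { (c , _ , (b , p , c∈F) , z∈G) →
              proj₂ D≐⋃h (b , p , proj₂ (hb≐⋃G b p) (c , c∈F , z∈G)) })

⋆-assoc : ∀ {W X Y Z} {R : MRel W X} {S : MRel X Y} {T : MRel Y Z} →
          Univalent S → Univalent T → ((R ⋆ S) ⋆ T) ≡ₘ (R ⋆ (S ⋆ T))
⋆-assoc {R = R} {S} {T} univS univT a D =
  ⋆-assoc-⊆ {R = R} {S} {T} , ⋆-assoc-⊇ {R = R} univS univT

1ₘ-univalent : ∀ X → Univalent (1ₘ X)
1ₘ-univalent X = 1ₘ-isMultirel X , 1ₘ-isUnivalent X

1ₘ-deterministic : ∀ X → Deterministic (1ₘ X)
1ₘ-deterministic X = 1ₘ-isMultirel X , 1ₘ-isTotal X , 1ₘ-isUnivalent X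

⋆-univalent : ∀ {X Y Z} {R : MRel X Y} {S : MRel Y Z} →
              Univalent R → Univalent S → Univalent (R ⋆ S)
⋆-univalent {R = R} {S} (_ , unR) (_ , unS) =
  ⋆-isMultirel R S , ⋆-isUnivalent {R = R} {S} unR unS

⋆-deterministic : ∀ {X Y Z} {R : MRel X Y} {S : MRel Y Z} →
                  Deterministic R → Deterministic S → Deterministic (R ⋆ S)
⋆-deterministic {R = R} {S} (_ , totR , unR) (_ , totS , unS) =
  ⋆-isMultirel R S , ⋆-isTotal {R = R} {S} totR totS , ⋆-isUnivalent {R = R} {S} unR unS

univalentSubcategory : (P : ∀ {X Y : Set} → MRel X Y → Set₁) →
                       (∀ {X Y} {R : MRel X Y} → P R → Univalent R) →
                       (∀ X → P (1ₘ X)) →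
                       (∀ {X Y Z} {R : MRel X Y} {S : MRel Y Z} → P R → P S → P (R ⋆ S)) →
                       IsCategory P
univalentSubcategory P univ id-closed comp-closed = record
  { id-closed   = id-closed
  ; comp-closed = comp-closed
  ; comp-cong   = λ _ _ _ _ → ⋆-cong
  ; identityˡ   = λ pR → ⋆-identityˡ (proj₁ (univ pR))
  ; identityʳ   = λ pR → ⋆-identityʳ (proj₁ (univ pR))
  ; assoc       = λ _ pS pT → ⋆-assoc (univ pS) (univ pT)
  }

proposition2p8 : IsCategory Univalent × IsCategory Deterministic
proposition2p8 =
    univalentSubcategory Univalent (λ univR → univR) 1ₘ-univalent ⋆-univalent
  , univalentSubcategory Deterministic deterministic⇒univalent 1ₘ-deterministic ⋆-deterministic
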